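{- Let $r\ge 2$ and $t\ge 1$ be integers and let $g$ be a real number. The following two statements are equivalent: (i) every $r$-uniform $\tau$-critical hypergraph $H$ with $\tau(H)=t$ has at most $g$ vertices (that is, $v_{max}(r,t)\le g$); (ii) every $r$-uniform $(n,k)$-witness hypergraph with $k=n-t$ satisfies $n\le g$.
   Context: All hypergraphs are finite. An $r$-uniform hypergraph $H=(V,E)$ has $E$ a family of $r$-element subsets of $V$; its order is $|V|$. A transversal of $H$ is a set $T\subseteq V$ with $e\cap T\neq\varnothing$ for every $e\in E$, and $\tau(H)$ is the minimum size of a transversal. A clique of $H$ is a set $N\subseteq V$ such that every $r$-element subset of $N$ belongs to $E$; a $k$-clique is a clique with $k$ vertices, and the clique number $\omega(H)$ is the maximum size of a clique. $H$ is $\tau$-critical if it has no isolated vertex (i.e. $\bigcup_{e\in E}e=V$) and $\tau(H-e)=\tau(H)-1$ for every $e\in E$, where $H-e=(V,E\setminus\{e\})$. $v_{max}(r,t)$ denotes the maximum order of an $r$-uniform $\tau$-critical hypergraph $H$ with $\tau(H)=t$. An $r$-uniform $(n,k)$-witness hypergraph is an $r$-uniform hypergraph $H$ of order $n$ with $\omega(H)=k$ such that the $k$-cliques of $H$ have no vertex common to all of them.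
   Formalization: The bound g ranges over the rationals rather than over all real numbers. -}

module Defs where

open import Data.Nat using (ℕ; _≤_; _∸_)
open import Data.Fin using (Fin)
open import Data.Fin.Subset using (Subset; _∈_; _∉_; _⊆_; ∣_∣)
open import Data.Product using (Σ; ∃; _×_)
open import Relation.Binary.PropositionalEquality using (_≡_; _≢_)

record Hypergraph (n : ℕ) : Set₁ where
  field
    Edge : Subset n → Set
open Hypergraph public

Uniform : ∀ {n} → ℕ → Hypergraph n → Set
Uniform r H = ∀ e → Edge H e → ∣ e ∣ ≡ r

deleteEdge : ∀ {n} → Hypergraph n → Subset n → Hypergraph n
deleteEdge H e = record { Edge = λ x → Edge H x × x ≢ e }

IsTransversal : ∀ {n} → Hypergraph n → Subset n → Set
IsTransversal H T = ∀ e → Edge H e → ∃ λ v → v ∈ e × v ∈ T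

HasTau : ∀ {n} → Hypergraph n → ℕ → Set
HasTau H m =
  (Σ _ λ T → IsTransversal H T × ∣ T ∣ ≡ m) ×
  (∀ T → IsTransversal H T → m ≤ ∣ T ∣)

NoIsolated : ∀ {n} → Hypergraph n → Set
NoIsolated {n} H = (v : Fin n) → ∃ λ e → Edge H e × v ∈ e

TauCritical : ∀ {n} → Hypergraph n → Set
TauCritical H =
  NoIsolated H ×
  (∀ e → Edge H e → ∀ m → HasTau H m → HasTau (deleteEdge H e) (m ∸ 1))

IsClique : ∀ {n} → ℕ → Hypergraph n → Subset n → Set
IsClique r H N = ∀ e → e ⊆ N → ∣ e ∣ ≡ r → Edge H e

HasOmega : ∀ {n} → ℕ → Hypergraph n → ℕ → Set
HasOmega r H k =
  (Σ _ λ N → IsClique r H N × ∣ N ∣ ≡ k) ×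
  (∀ N → IsClique r H N → ∣ N ∣ ≤ k)

IsWitness : ∀ {n} → ℕ → ℕ → Hypergraph n → Set
IsWitness {n} r k H =
  Uniform r H × HasOmega r H k ×
  ((v : Fin n) → Σ _ λ N → IsClique r H N × ∣ N ∣ ≡ k × v ∉ N)

{-# OPTIONS --safe #-}
module Submission where

-- The r-subsets of the vertex set split into the edges of G and of its complement H,
-- so T is a transversal of H iff ∁ T is a clique of G. Hence ω(G) = n − τ(H), and the
-- k-cliques of G have no common vertex iff every vertex lies in a minimum transversal
-- of H. A τ-critical H has this property: a vertex v on an edge e extends a minimum
-- transversal of H − e. Conversely, if G is a witness, deleting edges of H while τ stays
-- t ends in a τ-critical hypergraph on all n vertices, since a vertex v of a minimum
-- transversal T cannot become isolated (T − v would remain a transversal). That deletion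
-- process is classical, so this direction is proved under double negation, which is
-- enough because n ≤ g is decidable.

open import Defs
open import Data.Nat using (ℕ; _+_)
open import Data.Integer using (+_)
open import Data.Rational using (ℚ; _/_; _≤_)
open import Function.Bundles using (_⇔_)
open import Relation.Binary.PropositionalEquality using (_≡_)

open import Level using (Level)
open import Data.Nat as ℕ using (zero; suc; _∸_; s≤s)
import Data.Nat.Properties as ℕ
import Data.Rational.Properties as ℚ
open import Data.Fin using (Fin)
open import Data.Fin.Properties using (any?)
open import Data.Fin.Subset
  using (Subset; Nonempty; inside; outside; _∈_; _∉_; _⊆_; ∣_∣; ∁; _∪_; ⁅_⁆; _-_)
open import Data.Fin.Subset.Properties
  using (_∈?_; x∈p⇒x∉∁p; x∉p⇒x∈∁p; x∈p∪q⁺; x∈⁅x⁆; ∣⁅x⁆∣≡1; x∈p∧x≢y⇒x∈p-y;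
         x∈p⇒∣p-x∣<∣p∣; ∣∁p∣≡n∸∣p∣; ∣p∣≤n)
open import Data.Vec using ([]; _∷_; here; there)
open import Data.List using (List; []; _∷_; _++_; map; allFin)
open import Data.List.Membership.Propositional using () renaming (_∈_ to _∈ₗ_; _∉_ to _∉ₗ_)
open import Data.List.Membership.Propositional.Properties
  using (∈-++⁺ˡ; ∈-++⁺ʳ; ∈-map⁺; ∈-allFin)
open import Data.List.Relation.Unary.All using (All; []; _∷_; lookup)
import Data.List.Relation.Unary.Any as Any
import Data.Vec.Properties as Vec
import Data.Bool.Properties as Bool
open import Data.Product using (∃; _×_; _,_; proj₁; proj₂)
open import Data.Sum using (inj₁; inj₂; [_,_])
open import Function.Base using (_∘_; case_of_)
open import Function.Bundles using (mk⇔)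
open import Relation.Nullary using (¬_; Dec; yes; no)
open import Relation.Nullary.Decidable
  using (_×-dec_; ¬?; decidable-stable; ¬¬-excluded-middle)
open import Relation.Nullary.Negation using (contradiction; negated-stable; ¬¬-map)
open import Relation.Binary.PropositionalEquality
  using (refl; sym; trans; cong; subst; module ≡-Reasoning)

private
  variable
    a b : Level
    A : Set a
    B : Set b
    n r t k : ℕ
    p q : Subset n
    e : Subset n
    G H H₁ H₂ : Hypergraph n

_>>=_ : ¬ ¬ A → (A → ¬ ¬ B) → ¬ ¬ B
¬¬a >>= f = negated-stable (¬¬-map f ¬¬a)

¬¬-All : {P : A → Set b} → (∀ x → ¬ ¬ P x) → (xs : List A) → ¬ ¬ All P xs
¬¬-All ¬¬P []       = contradiction []
¬¬-All ¬¬P (x ∷ xs) = do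
  px  ← ¬¬P x
  pxs ← ¬¬-All ¬¬P xs
  contradiction (px ∷ pxs)

¬¬-∀-listed : {P : A → Set b} (xs : List A) → (∀ x → x ∈ₗ xs) →
              (∀ x → ¬ ¬ P x) → ¬ ¬ (∀ x → P x)
¬¬-∀-listed xs complete ¬¬P = ¬¬-map (λ all x → lookup all (complete x)) (¬¬-All ¬¬P xs)

allSubsets : ∀ n → List (Subset n)
allSubsets zero    = [] ∷ []
allSubsets (suc n) = map (inside ∷_) (allSubsets n) ++ map (outside ∷_) (allSubsets n)

∈-allSubsets : (p : Subset n) → p ∈ₗ allSubsets n
∈-allSubsets []            = Any.here refl
∈-allSubsets (inside ∷ p)  = ∈-++⁺ˡ (∈-map⁺ (inside ∷_) (∈-allSubsets p))
∈-allSubsets (outside ∷ p) = ∈-++⁺ʳ _ (∈-map⁺ (outside ∷_) (∈-allSubsets p))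

∣p∪q∣≤∣p∣+∣q∣ : (p q : Subset n) → ∣ p ∪ q ∣ ℕ.≤ ∣ p ∣ + ∣ q ∣
∣p∪q∣≤∣p∣+∣q∣ []            []            = ℕ.z≤n
∣p∪q∣≤∣p∣+∣q∣ (inside ∷ p)  (inside ∷ q)  =
  s≤s (ℕ.≤-trans (∣p∪q∣≤∣p∣+∣q∣ p q) (ℕ.+-monoʳ-≤ ∣ p ∣ (ℕ.n≤1+n _)))
∣p∪q∣≤∣p∣+∣q∣ (inside ∷ p)  (outside ∷ q) = s≤s (∣p∪q∣≤∣p∣+∣q∣ p q)
∣p∪q∣≤∣p∣+∣q∣ (outside ∷ p) (inside ∷ q)  =
  ℕ.≤-trans (s≤s (∣p∪q∣≤∣p∣+∣q∣ p q)) (ℕ.≤-reflexive (sym (ℕ.+-suc ∣ p ∣ ∣ q ∣)))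
∣p∪q∣≤∣p∣+∣q∣ (outside ∷ p) (outside ∷ q) = ∣p∪q∣≤∣p∣+∣q∣ p q

∣p∪⁅x⁆∣≤1+∣p∣ : (p : Subset n) (x : Fin n) → ∣ p ∪ ⁅ x ⁆ ∣ ℕ.≤ suc ∣ p ∣
∣p∪⁅x⁆∣≤1+∣p∣ p x = ℕ.≤-trans (∣p∪q∣≤∣p∣+∣q∣ p ⁅ x ⁆)
  (ℕ.≤-reflexive (trans (cong (_+_ ∣ p ∣) (∣⁅x⁆∣≡1 x)) (ℕ.+-comm ∣ p ∣ 1)))

∣p∣+∣∁p∣≡n : (p : Subset n) → ∣ p ∣ + ∣ ∁ p ∣ ≡ n
∣p∣+∣∁p∣≡n p = trans (cong (_+_ ∣ p ∣) (∣∁p∣≡n∸∣p∣ p)) (ℕ.m+[n∸m]≡n (∣p∣≤n p))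

∣p∣≡k⇒∣∁p∣≡t : (p : Subset n) → k + t ≡ n → ∣ p ∣ ≡ k → ∣ ∁ p ∣ ≡ t
∣p∣≡k⇒∣∁p∣≡t {k = k} p k+t≡n ∣p∣≡k = ℕ.+-cancelˡ-≡ k _ _ (begin
  k + ∣ ∁ p ∣     ≡⟨ cong (_+ ∣ ∁ p ∣) (sym ∣p∣≡k) ⟩
  ∣ p ∣ + ∣ ∁ p ∣ ≡⟨ ∣p∣+∣∁p∣≡n p ⟩
  _               ≡⟨ sym k+t≡n ⟩
  k + _           ∎)
  where open ≡-Reasoning

∣∁p∣≤k⇒t≤∣p∣ : (p : Subset n) → k + t ≡ n → ∣ ∁ p ∣ ℕ.≤ k → t ℕ.≤ ∣ p ∣
∣∁p∣≤k⇒t≤∣p∣ {k = k} {t = t} p k+t≡n ∣∁p∣≤k = ℕ.+-cancelˡ-≤ k _ _ (begin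
  k + t           ≡⟨ trans k+t≡n (sym (∣p∣+∣∁p∣≡n p)) ⟩
  ∣ p ∣ + ∣ ∁ p ∣ ≤⟨ ℕ.+-monoʳ-≤ ∣ p ∣ ∣∁p∣≤k ⟩
  ∣ p ∣ + k       ≡⟨ ℕ.+-comm ∣ p ∣ k ⟩
  k + ∣ p ∣       ∎)
  where open ℕ.≤-Reasoning

t≤∣∁p∣⇒∣p∣≤k : (p : Subset n) → k + t ≡ n → t ℕ.≤ ∣ ∁ p ∣ → ∣ p ∣ ℕ.≤ k
t≤∣∁p∣⇒∣p∣≤k {k = k} {t = t} p k+t≡n t≤∣∁p∣ = ℕ.+-cancelʳ-≤ t _ _ (begin
  ∣ p ∣ + t       ≤⟨ ℕ.+-monoʳ-≤ ∣ p ∣ t≤∣∁p∣ ⟩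
  ∣ p ∣ + ∣ ∁ p ∣ ≡⟨ trans (∣p∣+∣∁p∣≡n p) (sym k+t≡n) ⟩
  k + t           ∎)
  where open ℕ.≤-Reasoning

0<∣p∣⇒Nonempty : (p : Subset n) → 0 ℕ.< ∣ p ∣ → Nonempty p
0<∣p∣⇒Nonempty (inside ∷ p)  _       = Fin.zero , here
0<∣p∣⇒Nonempty (outside ∷ p) 0<∣p∣ with 0<∣p∣⇒Nonempty p 0<∣p∣
... | x , x∈p = Fin.suc x , there x∈p

p⊈q⇒∃x∈p∧x∉q : ¬ p ⊆ q → ∃ λ x → x ∈ p × x ∉ q
p⊈q⇒∃x∈p∧x∉q {p = p} {q = q} p⊈q =
  decidable-stable (any? λ x → x ∈? p ×-dec ¬? (x ∈? q)) λ ∄x →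
    p⊈q λ {x} x∈p → decidable-stable (x ∈? q) λ x∉q → ∄x (x , x∈p , x∉q)

_≟_ : (p q : Subset n) → Dec (p ≡ q)
_≟_ = Vec.≡-dec Bool._≟_

_⊑_ : Hypergraph n → Hypergraph n → Set
H₁ ⊑ H₂ = ∀ e → Edge H₁ e → Edge H₂ e

⊑-trans : H₁ ⊑ H₂ → H₂ ⊑ H → H₁ ⊑ H
⊑-trans H₁⊑H₂ H₂⊑H e = H₂⊑H e ∘ H₁⊑H₂ e

deleteEdge-⊑ : deleteEdge H e ⊑ H
deleteEdge-⊑ _ = proj₁

deleteEdge-mono : H₁ ⊑ H₂ → deleteEdge H₁ e ⊑ deleteEdge H₂ e
deleteEdge-mono H₁⊑H₂ x (x∈H₁ , x≢e) = H₁⊑H₂ x x∈H₁ , x≢e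

transversal-⊑ : H₁ ⊑ H₂ → IsTransversal H₂ p → IsTransversal H₁ p
transversal-⊑ H₁⊑H₂ p-tr e e∈H₁ = p-tr e (H₁⊑H₂ e e∈H₁)

transversal-deleteEdge : (x : Fin n) → x ∈ e →
  IsTransversal (deleteEdge H e) p → IsTransversal H (p ∪ ⁅ x ⁆)
transversal-deleteEdge {e = e} x x∈e p-tr f f∈H with f ≟ e
... | yes refl = x , x∈e , x∈p∪q⁺ (inj₂ (x∈⁅x⁆ x))
... | no f≢e with p-tr f (f∈H , f≢e)
...   | y , y∈f , y∈p = y , y∈f , x∈p∪q⁺ (inj₁ y∈p)

TauAtLeast : ℕ → Hypergraph n → Set
TauAtLeast t H = ∀ T → IsTransversal H T → t ℕ.≤ ∣ T ∣

HasTau-unique : HasTau H t → HasTau H k → t ≡ k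
HasTau-unique ((T , T-tr , ∣T∣≡t) , τ≥t) ((S , S-tr , ∣S∣≡k) , τ≥k) =
  ℕ.≤-antisym (ℕ.≤-trans (τ≥t S S-tr) (ℕ.≤-reflexive ∣S∣≡k))
              (ℕ.≤-trans (τ≥k T T-tr) (ℕ.≤-reflexive ∣T∣≡t))

HasTau-⊑ : H₁ ⊑ H₂ → HasTau H₂ t → TauAtLeast t H₁ → HasTau H₁ t
HasTau-⊑ H₁⊑H₂ ((T , T-tr , ∣T∣≡t) , _) τ≥t = (T , transversal-⊑ H₁⊑H₂ T-tr , ∣T∣≡t) , τ≥t

Critical : ℕ → Hypergraph n → Subset n → Set
Critical t H e = ∃ λ T → IsTransversal (deleteEdge H e) T × ∣ T ∣ ℕ.< t

Critical-⊑ : H₁ ⊑ H₂ → Critical t H₂ e → Critical t H₁ e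
Critical-⊑ H₁⊑H₂ (T , T-tr , ∣T∣<t) = T , transversal-⊑ (deleteEdge-mono H₁⊑H₂) T-tr , ∣T∣<t

¬TauAtLeast⇒¬¬Critical : ¬ TauAtLeast t (deleteEdge H e) → ¬ ¬ Critical t H e
¬TauAtLeast⇒¬¬Critical {t = t} ¬τ≥t ¬crit = ¬τ≥t λ T T-tr →
  decidable-stable (t ℕ.≤? ∣ T ∣) λ t≰∣T∣ → ¬crit (T , T-tr , ℕ.≰⇒> t≰∣T∣)

deleteEdge-HasTau : Nonempty e → TauAtLeast (suc t) H → Critical (suc t) H e →
                    HasTau (deleteEdge H e) t
deleteEdge-HasTau {e = e} {t = t} {H = H} (x , x∈e) τ≥1+t (T , T-tr , ∣T∣<1+t) =
  (T , T-tr , ℕ.≤-antisym (ℕ.≤-pred ∣T∣<1+t) (τ≥t T T-tr)) , τ≥t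
  where
  τ≥t : TauAtLeast t (deleteEdge H e)
  τ≥t S S-tr = ℕ.≤-pred (ℕ.≤-trans (τ≥1+t _ (transversal-deleteEdge x x∈e S-tr))
                                    (∣p∪⁅x⁆∣≤1+∣p∣ S x))

EdgeMinimal : ℕ → Hypergraph n → Set
EdgeMinimal t H = TauAtLeast t H × (∀ e → Edge H e → Critical t H e)

-- Deletes each listed edge whose removal keeps τ ≥ t.
minimise : (es : List (Subset n)) → TauAtLeast t H →
           (∀ e → Edge H e → e ∉ₗ es → Critical t H e) →
           ¬ ¬ (∃ λ H* → H* ⊑ H × EdgeMinimal t H*)
minimise {H = H} [] τ≥t crit =
  contradiction (H , (λ _ e∈H → e∈H) , τ≥t , λ e e∈H → crit e e∈H λ ())
minimise {t = t} {H = H} (e ∷ es) τ≥t crit = ¬¬-excluded-middle >>= delete-e?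
  where
  delete-e? : Dec (TauAtLeast t (deleteEdge H e)) → ¬ ¬ (∃ λ H* → H* ⊑ H × EdgeMinimal t H*)
  delete-e? (yes τ≥t-e) = do
    H* , H*⊑H-e , H*-min ← minimise es τ≥t-e λ f (f∈H , f≢e) f∉es →
      Critical-⊑ deleteEdge-⊑ (crit f f∈H ([ f≢e , f∉es ] ∘ Any.toSum))
    contradiction (H* , ⊑-trans H*⊑H-e deleteEdge-⊑ , H*-min)
  delete-e? (no ¬τ≥t-e) = do
    e-crit ← ¬TauAtLeast⇒¬¬Critical ¬τ≥t-e
    minimise es τ≥t λ f f∈H f∉es → case f ≟ e of λ where
      (yes refl) → e-crit
      (no f≢e)   → crit f f∈H ([ f≢e , f∉es ] ∘ Any.toSum)

¬¬-EdgeMinimal-⊑ : TauAtLeast t H → ¬ ¬ (∃ λ H* → H* ⊑ H × EdgeMinimal t H*)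
¬¬-EdgeMinimal-⊑ τ≥t =
  minimise (allSubsets _) τ≥t λ e _ e∉all → contradiction (∈-allSubsets e) e∉all

EveryVertexInTransversal : ℕ → Hypergraph n → Set
EveryVertexInTransversal {n} t H =
  (v : Fin n) → ∃ λ T → IsTransversal H T × ∣ T ∣ ≡ t × v ∈ T

EveryVertexInTransversal-⊑ : H₁ ⊑ H₂ → EveryVertexInTransversal t H₂ →
                             EveryVertexInTransversal t H₁
EveryVertexInTransversal-⊑ H₁⊑H₂ cover v with cover v
... | T , T-tr , ∣T∣≡t , v∈T = T , transversal-⊑ H₁⊑H₂ T-tr , ∣T∣≡t , v∈T

-- An isolated vertex could be dropped from a transversal of size t, contradicting τ ≥ t.
¬¬-NoIsolated : TauAtLeast t H → EveryVertexInTransversal t H → ¬ ¬ NoIsolated H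
¬¬-NoIsolated {t = t} {H = H} τ≥t cover = ¬¬-∀-listed (allFin _) ∈-allFin ¬¬-incident
  where
  ¬¬-incident : ∀ v → ¬ ¬ (∃ λ e → Edge H e × v ∈ e)
  ¬¬-incident v v-isolated with cover v
  ... | T , T-tr , ∣T∣≡t , v∈T = ℕ.<⇒≱ ∣T-v∣<t (τ≥t (T - v) T-v-tr)
    where
    ∣T-v∣<t : ∣ T - v ∣ ℕ.< t
    ∣T-v∣<t = ℕ.<-≤-trans (x∈p⇒∣p-x∣<∣p∣ v∈T) (ℕ.≤-reflexive ∣T∣≡t)
    T-v-tr : IsTransversal H (T - v)
    T-v-tr e e∈H with T-tr e e∈H
    ... | x , x∈e , x∈T = x , x∈e , x∈p∧x≢y⇒x∈p-y x∈T λ { refl → v-isolated (e , e∈H , x∈e) }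

TauCritical⇒EveryVertexInTransversal : TauCritical H → HasTau H (suc t) →
                                        EveryVertexInTransversal (suc t) H
TauCritical⇒EveryVertexInTransversal {H = H} {t = t} (no-isolated , critical) τ≡1+t v
  with no-isolated v
... | e , e∈H , v∈e with critical e e∈H (suc t) τ≡1+t
...   | (T , T-tr , ∣T∣≡t) , _ =
  T ∪ ⁅ v ⁆ , T+v-tr , ℕ.≤-antisym ∣T+v∣≤1+t (proj₂ τ≡1+t _ T+v-tr) , x∈p∪q⁺ (inj₂ (x∈⁅x⁆ v))
  where
  T+v-tr : IsTransversal H (T ∪ ⁅ v ⁆)
  T+v-tr = transversal-deleteEdge v v∈e T-tr
  ∣T+v∣≤1+t : ∣ T ∪ ⁅ v ⁆ ∣ ℕ.≤ suc t
  ∣T+v∣≤1+t = ℕ.≤-trans (∣p∪⁅x⁆∣≤1+∣p∣ T v) (s≤s (ℕ.≤-reflexive ∣T∣≡t))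

EdgeMinimal⇒deleteEdge-HasTau : (∀ e → Edge H e → Nonempty e) → EdgeMinimal (suc t) H →
  HasTau H (suc t) → ∀ e → Edge H e → ∀ m → HasTau H m → HasTau (deleteEdge H e) (m ∸ 1)
EdgeMinimal⇒deleteEdge-HasTau nonempty (τ≥1+t , critical) τ≡1+t e e∈H m τ≡m
  rewrite HasTau-unique τ≡m τ≡1+t = deleteEdge-HasTau (nonempty e e∈H) τ≥1+t (critical e e∈H)

complement : ℕ → Hypergraph n → Hypergraph n
complement r H = record { Edge = λ e → ∣ e ∣ ≡ r × ¬ Edge H e }

record Complementary (r : ℕ) (G H : Hypergraph n) : Set where
  field
    uniform  : Uniform r H
    disjoint : ∀ e → Edge H e → ¬ Edge G e
    covers   : ∀ e → ∣ e ∣ ≡ r → ¬ Edge H e → Edge G e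

complement-Complementary : Uniform r H → Complementary r (complement r H) H
complement-Complementary uniform = record
  { uniform  = uniform
  ; disjoint = λ _ e∈H (_ , e∉H) → e∉H e∈H
  ; covers   = λ _ ∣e∣≡r e∉H → ∣e∣≡r , e∉H
  }

Complementary-complement : (∀ e → Dec (Edge G e)) → Complementary r G (complement r G)
Complementary-complement G? = record
  { uniform  = λ _ → proj₁
  ; disjoint = λ _ → proj₂
  ; covers   = λ e ∣e∣≡r e∉H → decidable-stable (G? e) λ e∉G → e∉H (∣e∣≡r , e∉G)
  }

module _ {n r : ℕ} {G H : Hypergraph n} (GH : Complementary r G H) where
  open Complementary GH

  transversal⇒∁-clique : IsTransversal H p → IsClique r G (∁ p)
  transversal⇒∁-clique p-tr e e⊆∁p ∣e∣≡r = covers e ∣e∣≡r λ e∈H →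
    let x , x∈e , x∈p = p-tr e e∈H in x∈p⇒x∉∁p x∈p (e⊆∁p x∈e)

  clique⇒∁-transversal : IsClique r G p → IsTransversal H (∁ p)
  clique⇒∁-transversal p-clique e e∈H =
    let x , x∈e , x∉p = p⊈q⇒∃x∈p∧x∉q λ e⊆p → disjoint e e∈H (p-clique e e⊆p (uniform e e∈H))
    in x , x∈e , x∉p⇒x∈∁p x∉p

  module _ {k t : ℕ} (k+t≡n : k + t ≡ n) where

    private
      t+k≡n : t + k ≡ n
      t+k≡n = trans (ℕ.+-comm t k) k+t≡n

    HasOmega⇒HasTau : HasOmega r G k → HasTau H t
    HasOmega⇒HasTau ((N , N-clique , ∣N∣≡k) , ω≤k) =
      (∁ N , clique⇒∁-transversal N-clique , ∣p∣≡k⇒∣∁p∣≡t N k+t≡n ∣N∣≡k) ,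
      λ T T-tr → ∣∁p∣≤k⇒t≤∣p∣ T k+t≡n (ω≤k (∁ T) (transversal⇒∁-clique T-tr))

    HasTau⇒HasOmega : HasTau H t → HasOmega r G k
    HasTau⇒HasOmega ((T , T-tr , ∣T∣≡t) , τ≥t) =
      (∁ T , transversal⇒∁-clique T-tr , ∣p∣≡k⇒∣∁p∣≡t T t+k≡n ∣T∣≡t) ,
      λ N N-clique → t≤∣∁p∣⇒∣p∣≤k N k+t≡n (τ≥t (∁ N) (clique⇒∁-transversal N-clique))

    IsWitness⇒HasTau : IsWitness r k G → HasTau H t
    IsWitness⇒HasTau (_ , ω≡k , _) = HasOmega⇒HasTau ω≡k

    IsWitness⇒EveryVertexInTransversal : IsWitness r k G → EveryVertexInTransversal t H
    IsWitness⇒EveryVertexInTransversal (_ , _ , avoiding) v =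
      let N , N-clique , ∣N∣≡k , v∉N = avoiding v
      in ∁ N , clique⇒∁-transversal N-clique , ∣p∣≡k⇒∣∁p∣≡t N k+t≡n ∣N∣≡k , x∉p⇒x∈∁p v∉N

    EveryVertexInTransversal⇒IsWitness : Uniform r G → HasTau H t →
                                          EveryVertexInTransversal t H → IsWitness r k G
    EveryVertexInTransversal⇒IsWitness uniform-G τ≡t cover = uniform-G , ω≡k , avoiding
      where
      ω≡k : HasOmega r G k
      ω≡k = HasTau⇒HasOmega τ≡t
      avoiding : (v : Fin n) → ∃ λ N → IsClique r G N × ∣ N ∣ ≡ k × v ∉ N
      avoiding v =
        let T , T-tr , ∣T∣≡t , v∈T = cover v
        in ∁ T , transversal⇒∁-clique T-tr , ∣p∣≡k⇒∣∁p∣≡t T t+k≡n ∣T∣≡t , x∈p⇒x∉∁p v∈T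

uniform-Nonempty : 1 ℕ.≤ r → Uniform r H → ∀ e → Edge H e → Nonempty e
uniform-Nonempty 1≤r uniform e e∈H =
  0<∣p∣⇒Nonempty e (subst (1 ℕ.≤_) (sym (uniform e e∈H)) 1≤r)

TauCritical⇒IsWitness : ∀ {n r t} {H : Hypergraph n} →
                        Uniform r H → TauCritical H → HasTau H (suc t) →
                        ∃ λ k → k + suc t ≡ n × IsWitness r k (complement r H)
TauCritical⇒IsWitness {n} {t = t} uniform critical τ≡1+t@((T , _ , ∣T∣≡1+t) , _) =
  n ∸ suc t , k+t≡n ,
  EveryVertexInTransversal⇒IsWitness (complement-Complementary uniform) k+t≡n
    (λ _ → proj₁) τ≡1+t (TauCritical⇒EveryVertexInTransversal critical τ≡1+t)
  where
  k+t≡n : n ∸ suc t + suc t ≡ n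
  k+t≡n = ℕ.m∸n+n≡m (subst (ℕ._≤ n) ∣T∣≡1+t (∣p∣≤n T))

IsWitness⇒¬¬TauCritical : ∀ {n r k t} {G : Hypergraph n} →
                          1 ℕ.≤ r → IsWitness r k G → k + suc t ≡ n →
                          ¬ ¬ (∃ λ H → Uniform r H × TauCritical H × HasTau H (suc t))
IsWitness⇒¬¬TauCritical {r = r} 1≤r witness k+t≡n = do
  G? ← ¬¬-∀-listed (allSubsets _) ∈-allSubsets λ _ → ¬¬-excluded-middle
  let GH = Complementary-complement {r = r} G?
      τ≡1+t = IsWitness⇒HasTau GH k+t≡n witness
  H* , H*⊑H , H*-min@(τ*≥1+t , _) ← ¬¬-EdgeMinimal-⊑ (proj₂ τ≡1+t)
  let uniform* = λ e e∈H* → Complementary.uniform GH e (H*⊑H e e∈H*)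
      τ*≡1+t = HasTau-⊑ H*⊑H τ≡1+t τ*≥1+t
  no-isolated ← ¬¬-NoIsolated τ*≥1+t
    (EveryVertexInTransversal-⊑ H*⊑H (IsWitness⇒EveryVertexInTransversal GH k+t≡n witness))
  let critical* = EdgeMinimal⇒deleteEdge-HasTau (uniform-Nonempty 1≤r uniform*) H*-min τ*≡1+t
  contradiction (H* , uniform* , (no-isolated , critical*) , τ*≡1+t)

proposition4 : (r t : ℕ) → 2 Data.Nat.≤ r → 1 Data.Nat.≤ t → (g : ℚ) →
    ((n : ℕ) (H : Hypergraph n) → Uniform r H → TauCritical H → HasTau H t →
      (+ n) / 1 ≤ g)
    ⇔
    ((n k : ℕ) (H : Hypergraph n) → IsWitness r k H → k + t ≡ n →
      (+ n) / 1 ≤ g)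
proposition4 r zero    _   ()  g
proposition4 r (suc t) 2≤r _   g = mk⇔
  (λ bound-critical n k G witness k+t≡n →
    decidable-stable ((+ n) / 1 ℚ.≤? g)
      (¬¬-map (λ (H , uniform , critical , τ≡t) → bound-critical n H uniform critical τ≡t)
              (IsWitness⇒¬¬TauCritical (ℕ.<⇒≤ 2≤r) witness k+t≡n)))
  (λ bound-witness n H uniform critical τ≡t →
    let k , k+t≡n , witness = TauCritical⇒IsWitness uniform critical τ≡t
    in bound-witness n k (complement r H) witness k+t≡n)
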